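{- Let $H=(V,E_H,z)$ be a hypergraph with nonnegative hyperedge weights and let $G$ be either the associated graph of $H$ or a simple associated graph of $H$, with the map $\phi:E(G)\to E_H$ sending each edge of $G$ to the hyperedge it came from. Let $\beta>0$ and let $G'$ be an additive $\beta$-spanner of $G$. Then the sub-hypergraph $H'$ of $H$ with vertex set $V$ and hyperedge set $\{\phi(e')\mid e'\in E(G')\}$ is an additive $\beta$-hyperspanner of $H$, i.e. $\delta_{H'}(u,v)\le \delta_H(u,v)+\beta$ for all $u,v\in V$.
   Context: The associated graph of $H$ is the weighted multigraph on $V$ obtained by replacing each hyperedge $h$ with a clique on the vertices of $h$ whose edges all have weight $z(h)$. A simple associated graph of $H$ is obtained from the associated graph by keeping, for every pair of vertices, only one lightest edge among the parallel edges between them (ties broken arbitrarily). A subgraph $G'$ of a weighted graph $G$ on the same vertex set is an additive $\beta$-spanner if $\delta_{G'}(u,v)\le\delta_G(u,v)+\beta$ for all vertices $u,v$. Distances in a hypergraph: a $u$–$v$ path is a sequence $u=x_0,\dots,x_\ell=v$ with hyperedges $h_1,\dots,h_\ell$, $x_{j-1},x_j\in h_j$, of length $\sum_j z(h_j)$; $\delta_H(u,v)$ is the minimum such length.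
   Formalization: The hyperedge weights and the parameter β take rational values. -}

module Defs where

open import Data.Nat using (ℕ)
open import Data.Fin using (Fin) renaming (_<_ to _<ᶠ_)
open import Data.Fin.Subset using (Subset; _∈_)
open import Data.Rational using (ℚ; 0ℚ; _+_; _≤_; _<_)
open import Data.Product using (Σ; ∃; _×_; _,_)
open import Data.Sum using (_⊎_)
open import Data.Unit using (⊤)
open import Relation.Binary.PropositionalEquality using (_≡_)

-- A weighted hypergraph on vertex set V = Fin n, with hyperedges indexed by
-- Fin m (so parallel/equal hyperedges are allowed), vertex sets and weights z.
record Hypergraph (n : ℕ) : Set where
  field
    m    : ℕ
    edge : Fin m → Subset n
    z    : Fin m → ℚ

module _ {n : ℕ} (H : Hypergraph n) where
  open Hypergraph H

  NonnegWeights : Set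
  NonnegWeights = ∀ h → 0ℚ ≤ z h

  data HWalk (E' : Fin m → Set) : Fin n → Fin n → Set where
    []   : ∀ {x} → HWalk E' x x
    step : ∀ {x y w} (h : Fin m) → E' h → x ∈ edge h → y ∈ edge h →
           HWalk E' y w → HWalk E' x w

  hlen : ∀ {E' x y} → HWalk E' x y → ℚ
  hlen []                 = 0ℚ
  hlen (step h _ _ _ p)   = z h + hlen p

  AllHyperedges : Fin m → Set
  AllHyperedges _ = ⊤

  -- Edges of the associated graph: for every hyperedge h and every unordered
  -- pair {u,v} (u < v) of distinct vertices of h, one edge of weight z h.
  record AEdge : Set where
    constructor aedge
    field
      hy  : Fin m
      u   : Fin n
      v   : Fin n
      u<v : u <ᶠ v
      u∈  : u ∈ edge hy
      v∈  : v ∈ edge hy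

  open AEdge public

  φ : AEdge → Fin m
  φ = hy

  weight : AEdge → ℚ
  weight e = z (hy e)

  data GWalk (S : AEdge → Set) : Fin n → Fin n → Set where
    []   : ∀ {x} → GWalk S x x
    step : ∀ {x y w} (e : AEdge) → S e →
           ((x ≡ u e × y ≡ v e) ⊎ (x ≡ v e × y ≡ u e)) →
           GWalk S y w → GWalk S x w

  glen : ∀ {S x y} → GWalk S x y → ℚ
  glen []               = 0ℚ
  glen (step e _ _ p)   = weight e + glen p

  IsAssociated : (AEdge → Set) → Set
  IsAssociated S = ∀ e → S e

  -- S selects a simple associated graph: for every pair u < v lying in a
  -- common hyperedge exactly one of the parallel edges is kept, and it is a
  -- lightest one.
  IsSimpleAssociated : (AEdge → Set) → Set
  IsSimpleAssociated S =
      (∀ (e : AEdge) → ∃ λ e' → S e' × u e' ≡ u e × v e' ≡ v e)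
    × (∀ e e' → S e → S e' → u e ≡ u e' → v e ≡ v e' → hy e ≡ hy e')
    × (∀ e e' → S e → u e ≡ u e' → v e ≡ v e' → weight e ≤ weight e')

  -- G' (edge predicate S', a subgraph of S) is an additive β-spanner of S:
  -- δ_{G'}(x,y) ≤ δ_G(x,y) + β, i.e. every G-walk is matched by a G'-walk
  -- of length at most its length plus β.
  IsAdditiveSpanner : (S S' : AEdge → Set) → ℚ → Set
  IsAdditiveSpanner S S' β =
    (∀ e → S' e → S e) ×
    (∀ x y (p : GWalk S x y) → ∃ λ (q : GWalk S' x y) → glen q ≤ glen p + β)

  ImageHyperedges : (AEdge → Set) → Fin m → Set
  ImageHyperedges S' h = ∃ λ e → S' e × φ e ≡ h

  IsAdditiveHyperspanner : (Fin m → Set) → ℚ → Set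
  IsAdditiveHyperspanner E' β =
    ∀ x y (p : HWalk AllHyperedges x y) → ∃ λ (q : HWalk E' x y) → hlen q ≤ hlen p + β

{-# OPTIONS --safe #-}
-- A hypergraph walk lifts to a walk of no greater length in G: a step inside
-- a hyperedge h between distinct x, y becomes an edge of the associated graph
-- of weight z h, which G keeps or replaces by a lighter parallel edge, while a
-- step with x = y is dropped (weights are nonnegative). The spanner then gives
-- a G'-walk at most β longer, and mapping each of its edges e' to φ(e') yields
-- an H'-walk of the same length.
module Submission where

open import Defs
open import Data.Nat using (ℕ)
open import Data.Fin using (Fin)
open import Data.Fin.Properties using (<-cmp)
open import Data.Rational using (ℚ; 0ℚ; _<_; _≤_; _+_)
open import Data.Rational.Properties
  using (≤-refl; ≤-trans; +-identityˡ; +-monoˡ-≤; +-monoʳ-≤; module ≤-Reasoning)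
open import Data.Sum using (_⊎_; inj₁; inj₂)
open import Data.Product using (Σ; ∃; _×_; _,_)
open import Relation.Binary using (tri<; tri≈; tri>)
open import Relation.Binary.PropositionalEquality using (_≡_; refl; sym; cong)

module _ {n : ℕ} (H : Hypergraph n) where
  open Hypergraph H

  HasLighterParallels : (AEdge H → Set) → Set
  HasLighterParallels S =
    ∀ e → ∃ λ e′ → S e′ × u e′ ≡ u e × v e′ ≡ v e × weight H e′ ≤ weight H e

  associated⊎simple⇒hasLighterParallels :
    ∀ {S} → IsAssociated H S ⊎ IsSimpleAssociated H S → HasLighterParallels S
  associated⊎simple⇒hasLighterParallels (inj₁ all) e = e , all e , refl , refl , ≤-refl
  associated⊎simple⇒hasLighterParallels (inj₂ (kept , _ , lightest)) e with kept e
  ... | e′ , s , eu , ev = e′ , s , eu , ev , lightest e′ e s eu ev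

  GWalkLength≤ : (S : AEdge H → Set) → Fin n → Fin n → ℚ → Set
  GWalkLength≤ S x y ℓ = Σ (GWalk H S x y) λ q → glen H q ≤ ℓ

  module _ {S : AEdge H → Set} (lighter : HasLighterParallels S) where

    step-lighter : ∀ {x y w} (e : AEdge H) →
      ((x ≡ u e × y ≡ v e) ⊎ (x ≡ v e × y ≡ u e)) →
      (p : GWalk H S y w) → GWalkLength≤ S x w (weight H e + glen H p)
    step-lighter e ends p with lighter e
    ... | e′ , s , refl , refl , e′≤e = step e′ s ends p , +-monoˡ-≤ (glen H p) e′≤e

    hwalk⇒gwalk : NonnegWeights H → ∀ {x y} (p : HWalk H (AllHyperedges H) x y) →
      GWalkLength≤ S x y (hlen H p)
    hwalk⇒gwalk _ [] = [] , ≤-refl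
    hwalk⇒gwalk nonneg (step {x} {y} h _ x∈h y∈h p) with hwalk⇒gwalk nonneg p | <-cmp x y
    ... | q , q≤p | tri< x<y _ _ =
      let r , r≤ = step-lighter (aedge h x y x<y x∈h y∈h) (inj₁ (refl , refl)) q
      in r , ≤-trans r≤ (+-monoʳ-≤ (z h) q≤p)
    ... | q , q≤p | tri> _ _ y<x =
      let r , r≤ = step-lighter (aedge h y x y<x y∈h x∈h) (inj₂ (refl , refl)) q
      in r , ≤-trans r≤ (+-monoʳ-≤ (z h) q≤p)
    ... | q , q≤p | tri≈ _ refl _ = q , (begin
      glen H q           ≤⟨ q≤p ⟩
      hlen H p           ≡⟨ sym (+-identityˡ (hlen H p)) ⟩
      0ℚ + hlen H p      ≤⟨ +-monoˡ-≤ (hlen H p) (nonneg h) ⟩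
      z h + hlen H p     ∎)
      where open ≤-Reasoning

  gwalk⇒hwalk : ∀ {S′ x y} (q : GWalk H S′ x y) →
    Σ (HWalk H (ImageHyperedges H S′) x y) λ r → hlen H r ≡ glen H q
  gwalk⇒hwalk [] = [] , refl
  gwalk⇒hwalk (step e s ends q) with gwalk⇒hwalk q
  ... | r , r≡q with ends
  ... | inj₁ (refl , refl) = step (hy e) (e , s , refl) (u∈ e) (v∈ e) r , cong (z (hy e) +_) r≡q
  ... | inj₂ (refl , refl) = step (hy e) (e , s , refl) (v∈ e) (u∈ e) r , cong (z (hy e) +_) r≡q

corollary1 : {n : ℕ} (H : Hypergraph n) → NonnegWeights H →
    (S : AEdge H → Set) → (IsAssociated H S ⊎ IsSimpleAssociated H S) →
    (β : ℚ) → 0ℚ < β →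
    (S' : AEdge H → Set) → IsAdditiveSpanner H S S' β →
    IsAdditiveHyperspanner H (ImageHyperedges H S') β
corollary1 H nonneg S G-assoc β _ S' (_ , spanner) x y p
  with hwalk⇒gwalk H (associated⊎simple⇒hasLighterParallels H G-assoc) nonneg p
... | g , g≤p with spanner x y g
... | q , q≤g+β with gwalk⇒hwalk H q
... | r , r≡q = r , (begin
  hlen H r       ≡⟨ r≡q ⟩
  glen H q       ≤⟨ q≤g+β ⟩
  glen H g + β   ≤⟨ +-monoˡ-≤ β g≤p ⟩
  hlen H p + β   ∎)
  where open ≤-Reasoning
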